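{- Let $g:R^n\to\mathbb{Z}/p\mathbb{Z}$ and $d\in\{0,1,\dots,p-1\}$. Then $g\in\Omega^n_d$ if and only if $g$ is a polynomial of degree at most $d$, i.e. there is a polynomial $P\in R[x_1,\dots,x_n]$ of total degree at most $d$ with $g(x)=P(x)\bmod p$ for all $x\in R^n$.
   Context: Let $p$ be prime, $k,n\in\mathbb{N}$, $R=\mathbb{Z}/p^k\mathbb{Z}$ with representatives $\{0,\dots,p^k-1\}$, $[m]=\{0,\dots,m-1\}$. For $j\in[p^k]$, $\phi_j(x)=\binom{x}{j}\bmod p$ (representative of $x$, $\binom{a}{b}=0$ for $a<b$). For $\alpha\in[p^k]^n$, $\phi_\alpha(x)=\prod_i\phi_{\alpha_i}(x_i)$, $|\alpha|=\sum_i\alpha_i$; $\Omega^n_d=\operatorname{span}_{\mathbb{Z}/p\mathbb{Z}}\{\phi_\alpha:|\alpha|\le d\}$. -}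

module Defs where

open import Data.Nat using (ℕ; zero; suc; _+_; _*_; _^_; _≤_; _<_; NonZero)
open import Data.Nat.Properties using (m^n≢0)
open import Data.Nat.DivMod using (_%_)
open import Data.Nat.Primality using (Prime; prime⇒nonZero)
open import Data.Nat.Combinatorics using (_C_)
open import Data.Fin using (Fin; toℕ) renaming (zero to fz; suc to fs)
open import Data.List using (List)
open import Data.Nat.ListAction using (sum)
import Data.List as L
open import Data.List.Relation.Unary.All using (All)
open import Data.Product using (Σ; _×_; _,_; ∃)
open import Relation.Binary.PropositionalEquality using (_≡_)

Σᶠ : (n : ℕ) → (Fin n → ℕ) → ℕ
Σᶠ zero    f = 0
Σᶠ (suc n) f = f fz + Σᶠ n (λ i → f (fs i))

Πᶠ : (n : ℕ) → (Fin n → ℕ) → ℕ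
Πᶠ zero    f = 1
Πᶠ (suc n) f = f fz * Πᶠ n (λ i → f (fs i))

-- Points of R^n, R = ℤ/p^kℤ, each coordinate given by its representative in {0,…,p^k-1}.
-- Multi-indices α ∈ [p^k]^n use the same type.
Vecᴿ : ℕ → ℕ → ℕ → Set
Vecᴿ p k n = Fin n → Fin (p ^ k)

∣_∣ᵅ : ∀ {m n} → (Fin n → Fin m) → ℕ
∣_∣ᵅ {n = n} α = Σᶠ n (λ i → toℕ (α i))

module _ {p : ℕ} (pp : Prime p) (k n : ℕ) where
  private instance
    p≢0  : NonZero p
    p≢0  = prime⇒nonZero pp
    pk≢0 : NonZero (p ^ k)
    pk≢0 = m^n≢0 p k

  φ : ℕ → ℕ → ℕ
  φ j x = (x C j) % p

  φᵅ : Vecᴿ p k n → Vecᴿ p k n → ℕ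
  φᵅ α x = Πᶠ n (λ i → φ (toℕ (α i)) (toℕ (x i))) % p

  InΩ : ℕ → (Vecᴿ p k n → Fin p) → Set
  InΩ d g =
    Σ (List (Fin p × Vecᴿ p k n)) λ terms →
      All (λ { (c , α) → ∣ α ∣ᵅ ≤ d }) terms ×
      (∀ (x : Vecᴿ p k n) →
         toℕ (g x) ≡ sum (L.map (λ { (c , α) → toℕ c * φᵅ α x }) terms) % p)

  -- A polynomial in R[x₁,…,xₙ] given as a finite list of monomials
  -- (coefficient in R, exponent vector); its total degree is ≤ d iff every
  -- listed monomial has degree ≤ d.
  Poly : Set
  Poly = List (Fin (p ^ k) × (Fin n → ℕ))

  monoDeg : (Fin n → ℕ) → ℕ
  monoDeg e = Σᶠ n e

  evalᴿ : Poly → Vecᴿ p k n → ℕ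
  evalᴿ P x =
    sum (L.map (λ { (c , e) → toℕ c * Πᶠ n (λ i → toℕ (x i) ^ e i) }) P) % (p ^ k)

  IsPolyDeg≤ : ℕ → (Vecᴿ p k n → Fin p) → Set
  IsPolyDeg≤ d g =
    Σ Poly λ P →
      All (λ { (c , e) → monoDeg e ≤ d }) P ×
      (∀ (x : Vecᴿ p k n) → toℕ (g x) ≡ evalᴿ P x % p)

-- Both Ω^n_d and the functions of degree ≤ d are spans modulo p of a basis of
-- products of univariate functions, so it suffices to show that each univariate
-- basis element of degree e ≤ d lies in the span of the other basis up to degree e.
-- The recurrence  y · C(y,j) = (j+1) · C(y,j+1) + j · C(y,j)  expresses y^e as an
-- ℕ-combination of C(y,0), …, C(y,e); solved for C(y,j+1) it expresses C(y,j) as a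
-- combination of 1, y, …, y^j, which needs 1, …, j to be invertible modulo p, i.e. j < p.
-- Multiplying coordinates together adds degrees, which gives the n-variable case.
module Submission where

open import Defs
open import Data.Nat
open import Data.Nat.Properties
open import Data.Nat.DivMod
open import Data.Nat.Combinatorics using (_C_; nC1≡n; nCk+nC[k+1]≡[n+1]C[k+1]; k>n⇒nCk≡0)
open import Data.Nat.Divisibility using (_∣_; m∣m*n)
open import Data.Nat.Primality using (Prime; prime⇒nonZero)
open import Data.Nat.Coprimality using (prime⇒coprime; coprime-Bézout)
open import Data.Nat.GCD using (module Bézout)
open import Data.Nat.ListAction using (sum)
open import Data.Nat.ListAction.Properties using (sum-++)
open import Data.Nat.Tactic.RingSolver using (solve-∀)
open import Algebra.Properties.CommutativeSemigroup *-commutativeSemigroup using (x∙yz≈y∙xz)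
open import Data.Fin using (Fin; toℕ; fromℕ<)
open import Data.Fin.Properties using (toℕ-fromℕ<; toℕ<n)
open import Data.Vec.Functional using (head; tail) renaming (_∷_ to _◂_)
open import Data.List using (List; []; _∷_; _++_)
import Data.List as L
open import Data.List.Properties using (map-++)
open import Data.List.Relation.Unary.All using (All; []; _∷_)
open import Data.List.Relation.Unary.All.Properties using (map⁺; ++⁺)
open import Data.Product using (Σ-syntax; _×_; _,_; proj₁; proj₂)
open import Function using (_∘_; id; _$_)
open import Function.Bundles using (_⇔_; mk⇔)
open import Relation.Binary.PropositionalEquality using (_≡_; refl; sym; trans; cong; cong₂; subst; module ≡-Reasoning)

private variable
  X Z I J : Set

n*nCk≡[1+k]*nC[1+k]+k*nCk : ∀ n k → n * (n C k) ≡ suc k * (n C suc k) + k * (n C k)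
n*nCk≡[1+k]*nC[1+k]+k*nCk zero zero = refl
n*nCk≡[1+k]*nC[1+k]+k*nCk zero (suc k)
  rewrite k>n⇒nCk≡0 {0} {suc (suc k)} z<s | k>n⇒nCk≡0 {0} {suc k} z<s | *-zeroʳ (suc (suc k)) = refl
n*nCk≡[1+k]*nC[1+k]+k*nCk (suc n) zero =
  trans (*-identityʳ (suc n)) (sym (trans (+-identityʳ _) (trans (+-identityʳ _) (nC1≡n (suc n)))))
n*nCk≡[1+k]*nC[1+k]+k*nCk (suc n) (suc k) = begin
    suc n * (suc n C suc k)
  ≡⟨ cong (suc n *_) (sym (nCk+nC[k+1]≡[n+1]C[k+1] n k)) ⟩
    suc n * (a + b)
  ≡⟨ expand n a b ⟩
    a + b + n * a + n * b
  ≡⟨ cong₂ (λ u v → a + b + u + v) (n*nCk≡[1+k]*nC[1+k]+k*nCk n k) (n*nCk≡[1+k]*nC[1+k]+k*nCk n (suc k)) ⟩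
    a + b + (suc k * b + k * a) + (suc (suc k) * c + suc k * b)
  ≡⟨ regroup a b c k ⟩
    suc (suc k) * (b + c) + suc k * (a + b)
  ≡⟨ cong₂ (λ u v → suc (suc k) * u + suc k * v)
       (nCk+nC[k+1]≡[n+1]C[k+1] n (suc k)) (nCk+nC[k+1]≡[n+1]C[k+1] n k) ⟩
    suc (suc k) * (suc n C suc (suc k)) + suc k * (suc n C suc k)
  ∎
  where
    open ≡-Reasoning
    a = n C k
    b = n C suc k
    c = n C suc (suc k)
    expand : ∀ n a b → suc n * (a + b) ≡ a + b + n * a + n * b
    expand = solve-∀
    regroup : ∀ a b c k →
      a + b + (suc k * b + k * a) + (suc (suc k) * c + suc k * b) ≡ suc (suc k) * (b + c) + suc k * (a + b)
    regroup = solve-∀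

m∣m^n : ∀ {m n} → 1 ≤ n → m ∣ m ^ n
m∣m^n {m} {suc n} _ = m∣m*n (m ^ n)

m≤m^n : ∀ {m n} .{{_ : NonZero m}} → 1 ≤ n → m ≤ m ^ n
m≤m^n {m} {n} 1≤n = subst (_≤ m ^ n) (^-identityʳ m) (^-monoʳ-≤ m 1≤n)

pow binom : ℕ → ℕ → ℕ
pow e y = y ^ e
binom k y = y C k

tensor : (I → ℕ → ℕ) → ∀ {n} → (Fin n → I) → (Fin n → ℕ) → ℕ
tensor b {n} e x = Πᶠ n (λ i → b (e i) (x i))

tensorDeg : (I → ℕ) → ∀ {n} → (Fin n → I) → ℕ
tensorDeg deg {n} e = Σᶠ n (λ i → deg (e i))

module Modulo (m : ℕ) {{_ : NonZero m}} where

  infix 4 _≈_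
  _≈_ : ℕ → ℕ → Set
  a ≈ b = a % m ≡ b % m

  ≡⇒≈ : ∀ {a b} → a ≡ b → a ≈ b
  ≡⇒≈ = cong (_% m)

  %-≈ : ∀ a → a % m ≈ a
  %-≈ a = m%n%n≡m%n a m

  +-≈ : ∀ {a a' b b'} → a ≈ a' → b ≈ b' → a + b ≈ a' + b'
  +-≈ {a} {a'} {b} {b'} a≈a' b≈b' = begin
      (a + b) % m             ≡⟨ %-distribˡ-+ a b m ⟩
      (a % m + b % m) % m     ≡⟨ cong₂ (λ u v → (u + v) % m) a≈a' b≈b' ⟩
      (a' % m + b' % m) % m   ≡⟨ %-distribˡ-+ a' b' m ⟨
      (a' + b') % m           ∎
    where open ≡-Reasoning

  *-≈ : ∀ {a a' b b'} → a ≈ a' → b ≈ b' → a * b ≈ a' * b'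
  *-≈ {a} {a'} {b} {b'} a≈a' b≈b' = begin
      (a * b) % m               ≡⟨ %-distribˡ-* a b m ⟩
      (a % m * (b % m)) % m     ≡⟨ cong₂ (λ u v → (u * v) % m) a≈a' b≈b' ⟩
      (a' % m * (b' % m)) % m   ≡⟨ %-distribˡ-* a' b' m ⟨
      (a' * b') % m             ∎
    where open ≡-Reasoning

  Πᶠ-%-≈ : ∀ n (f : Fin n → ℕ) → Πᶠ n (λ i → f i % m) ≈ Πᶠ n f
  Πᶠ-%-≈ zero    f = refl
  Πᶠ-%-≈ (suc n) f = *-≈ (%-≈ (head f)) (Πᶠ-%-≈ n (tail f))

  -- −v modulo m is represented by (m ∸ 1) * v.
  u+v≡w⇒u≈w+[m∸1]*v : ∀ {u v w} → u + v ≡ w → u ≈ w + (m ∸ 1) * v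
  u+v≡w⇒u≈w+[m∸1]*v {u} {v} refl = sym $ begin
      (u + v + (m ∸ 1) * v) % m   ≡⟨ cong (_% m) (regroup u v (m ∸ 1)) ⟩
      (u + v * (1 + (m ∸ 1))) % m ≡⟨ cong (λ t → (u + v * t) % m) (m+[n∸m]≡n (>-nonZero⁻¹ m)) ⟩
      (u + v * m) % m             ≡⟨ [m+kn]%n≡m%n u v m ⟩
      u % m                       ∎
    where
      open ≡-Reasoning
      regroup : ∀ u v r → u + v + r * v ≡ u + v * (1 + r)
      regroup = solve-∀

  inverse : Prime m → ∀ {a} → 0 < a → a < m → Σ[ a⁻¹ ∈ ℕ ] a⁻¹ * a ≈ 1
  inverse pm {a} 0<a a<m with coprime-Bézout (prime⇒coprime pm {{>-nonZero 0<a}} a<m)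
  ... | Bézout.-+ x y 1+x*m≡y*a = y , (begin
      (y * a) % m                     ≡⟨ cong (_% m) 1+x*m≡y*a ⟨
      (1 + x * m) % m                 ≡⟨ [m+kn]%n≡m%n 1 x m ⟩
      1 % m                           ∎)
    where open ≡-Reasoning
  ... | Bézout.+- x y 1+y*a≡x*m = (m ∸ 1) * y , (begin
      ((m ∸ 1) * y * a) % m           ≡⟨ cong (_% m) (*-assoc (m ∸ 1) y a) ⟩
      ((m ∸ 1) * (y * a)) % m         ≡⟨ [m+kn]%n≡m%n _ x m ⟨
      ((m ∸ 1) * (y * a) + x * m) % m ≡⟨ cong (_% m) (+-comm _ (x * m)) ⟩
      (x * m + (m ∸ 1) * (y * a)) % m ≡⟨ u+v≡w⇒u≈w+[m∸1]*v 1+y*a≡x*m ⟨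
      1 % m                           ∎)
    where open ≡-Reasoning

  -- The ℤ/m-span of the b i with deg i ≤ d, functions being identified pointwise modulo m.
  data Span (b : I → X → ℕ) (deg : I → ℕ) (d : ℕ) : (X → ℕ) → Set where
    basis : ∀ i → deg i ≤ d → Span b deg d (b i)
    0ₛ    : Span b deg d (λ _ → 0)
    _+ₛ_  : ∀ {f g} → Span b deg d f → Span b deg d g → Span b deg d (λ x → f x + g x)
    _*ₛ_  : ∀ c {f} → Span b deg d f → Span b deg d (λ x → c * f x)
    resp  : ∀ {f g} → (∀ x → f x ≈ g x) → Span b deg d f → Span b deg d g

  infixl 6 _+ₛ_
  infixr 7 _*ₛ_

  module _ {b : I → X → ℕ} {deg : I → ℕ} where

    span-mono : ∀ {d d' f} → d ≤ d' → Span b deg d f → Span b deg d' f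
    span-mono d≤d' (basis i i≤d) = basis i (≤-trans i≤d d≤d')
    span-mono d≤d' 0ₛ            = 0ₛ
    span-mono d≤d' (s +ₛ t)      = span-mono d≤d' s +ₛ span-mono d≤d' t
    span-mono d≤d' (c *ₛ s)      = c *ₛ span-mono d≤d' s
    span-mono d≤d' (resp f≈g s)  = resp f≈g (span-mono d≤d' s)

    span-pull : ∀ {d f} (π : Z → X) → Span b deg d f → Span (λ i → b i ∘ π) deg d (f ∘ π)
    span-pull π (basis i i≤d) = basis i i≤d
    span-pull π 0ₛ            = 0ₛ
    span-pull π (s +ₛ t)      = span-pull π s +ₛ span-pull π t
    span-pull π (c *ₛ s)      = c *ₛ span-pull π s
    span-pull π (resp f≈g s)  = resp (f≈g ∘ π) (span-pull π s)

    span-bind : ∀ {b' : J → X → ℕ} {deg' d d' f} (h : X → ℕ) →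
      (∀ i → deg i ≤ d → Span b' deg' d' (λ x → h x * b i x)) →
      Span b deg d f → Span b' deg' d' (λ x → h x * f x)
    span-bind h H (basis i i≤d) = H i i≤d
    span-bind h H 0ₛ =
      resp (λ x → ≡⇒≈ (sym (*-zeroʳ (h x)))) 0ₛ
    span-bind h H (s +ₛ t) =
      resp (λ x → ≡⇒≈ (sym (*-distribˡ-+ (h x) _ _))) (span-bind h H s +ₛ span-bind h H t)
    span-bind h H (c *ₛ s) =
      resp (λ x → ≡⇒≈ (x∙yz≈y∙xz c (h x) _)) (c *ₛ span-bind h H s)
    span-bind h H (resp f≈g s) =
      resp (λ x → *-≈ {h x} refl (f≈g x)) (span-bind h H s)

    span-trans : ∀ {b' : J → X → ℕ} {deg' d d' f} →
      (∀ i → deg i ≤ d → Span b' deg' d' (b i)) → Span b deg d f → Span b' deg' d' f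
    span-trans H s =
      resp (λ x → ≡⇒≈ (*-identityˡ _))
        (span-bind (λ _ → 1) (λ i i≤d → resp (λ x → ≡⇒≈ (sym (*-identityˡ _))) (H i i≤d)) s)

  span-* : ∀ {I₁ I₂ I₃ : Set} {b₁ : I₁ → X → ℕ} {b₂ : I₂ → X → ℕ} {b₃ : I₃ → X → ℕ}
    {deg₁ deg₂ deg₃ d₁ d₂ f g} →
    (∀ i j → deg₁ i ≤ d₁ → deg₂ j ≤ d₂ → Span b₃ deg₃ (d₁ + d₂) (λ x → b₁ i x * b₂ j x)) →
    Span b₁ deg₁ d₁ f → Span b₂ deg₂ d₂ g → Span b₃ deg₃ (d₁ + d₂) (λ x → f x * g x)
  span-* {b₂ = b₂} {f = f} H sf sg =
    span-bind f (λ j j≤d₂ →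
      commute (b₂ j) f (span-bind (b₂ j) (λ i i≤d₁ → commute _ (b₂ j) (H i j i≤d₁ j≤d₂)) sf)) sg
    where
      commute : ∀ {K b deg d} (u v : X → ℕ) →
        Span {K} b deg d (λ x → u x * v x) → Span b deg d (λ x → v x * u x)
      commute u v = resp (λ x → ≡⇒≈ (*-comm (u x) (v x)))

  span-tensor : ∀ {b : I → ℕ → ℕ} {b' : J → ℕ → ℕ} {deg deg' D} →
    (∀ i → deg i ≤ D → Span b' deg' (deg i) (b i)) →
    ∀ n (e : Fin n → I) → tensorDeg deg e ≤ D →
    Span (tensor b') (tensorDeg deg') (tensorDeg deg e) (tensor b e)
  span-tensor H zero    e _ = basis (λ ()) z≤n
  span-tensor H (suc n) e e≤D =
    span-* (λ j e' j≤ e'≤ → basis (j ◂ e') (+-mono-≤ j≤ e'≤))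
      (span-pull head (H (head e) (m+n≤o⇒m≤o _ e≤D)))
      (span-pull tail (span-tensor H n (tail e) (m+n≤o⇒n≤o _ e≤D)))

  powers∈span-binomials : ∀ e → Span binom id e (pow e)
  powers∈span-binomials zero    = basis 0 z≤n
  powers∈span-binomials (suc e) =
    span-bind id
      (λ j j≤e → resp (λ y → ≡⇒≈ (sym (n*nCk≡[1+k]*nC[1+k]+k*nCk y j)))
                   (suc j *ₛ basis (suc j) (s≤s j≤e) +ₛ j *ₛ basis j (m≤n⇒m≤1+n j≤e)))
      (powers∈span-binomials e)

  binomials∈span-powers : Prime m → ∀ j → j < m → Span pow id j (binom j)
  binomials∈span-powers pm zero    _     = basis 0 z≤n
  binomials∈span-powers pm (suc j) 1+j<m with inverse pm {suc j} z<s 1+j<m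
  ... | j⁺⁻¹ , j⁺⁻¹*j⁺≈1 =
    resp solve (j⁺⁻¹ *ₛ (span-bind id (λ e e≤j → basis (suc e) (s≤s e≤j)) IH
                          +ₛ (m ∸ 1) *ₛ j *ₛ span-mono (n≤1+n j) IH))
    where
      IH = binomials∈span-powers pm j (<-trans (n<1+n j) 1+j<m)
      solve : ∀ y → j⁺⁻¹ * (y * (y C j) + (m ∸ 1) * (j * (y C j))) ≈ y C suc j
      solve y = begin
          (j⁺⁻¹ * (y * (y C j) + (m ∸ 1) * (j * (y C j)))) % m
        ≡⟨ *-≈ {j⁺⁻¹} refl (u+v≡w⇒u≈w+[m∸1]*v (sym (n*nCk≡[1+k]*nC[1+k]+k*nCk y j))) ⟨
          (j⁺⁻¹ * (suc j * (y C suc j))) % m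
        ≡⟨ cong (_% m) (*-assoc j⁺⁻¹ (suc j) _) ⟨
          (j⁺⁻¹ * suc j * (y C suc j)) % m
        ≡⟨ *-≈ j⁺⁻¹*j⁺≈1 refl ⟩
          (1 * (y C suc j)) % m
        ≡⟨ cong (_% m) (*-identityˡ _) ⟩
          (y C suc j) % m
        ∎
        where open ≡-Reasoning

  module _ {A : Set} (⟦_⟧ : A → ℕ) (b : I → X → ℕ) (deg : I → ℕ) where

    combination : List (A × I) → X → ℕ
    combination ts x = sum (L.map (λ t → ⟦ proj₁ t ⟧ * b (proj₂ t) x) ts)

    DegreeAtMost : ℕ → List (A × I) → Set
    DegreeAtMost d = All (λ t → deg (proj₂ t) ≤ d)

    combination∈span : ∀ {d ts} → DegreeAtMost d ts → Span b deg d (combination ts)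
    combination∈span                           []           = 0ₛ
    combination∈span {ts = (c , i) ∷ _} (i≤d ∷ ts≤d) = ⟦ c ⟧ *ₛ basis i i≤d +ₛ combination∈span ts≤d

    combination-++ : ∀ ts us x → combination (ts ++ us) x ≡ combination ts x + combination us x
    combination-++ ts us x = trans (cong sum (map-++ term ts us)) (sum-++ (L.map term ts) _)
      where term = λ t → ⟦ proj₁ t ⟧ * b (proj₂ t) x

    module _ (coeff : ℕ → A) (⟦coeff⟧≈ : ∀ c → ⟦ coeff c ⟧ ≈ c) where

      scaled : ℕ → List (A × I) → List (A × I)
      scaled c = L.map (λ t → coeff (c * ⟦ proj₁ t ⟧) , proj₂ t)

      combination-scaled : ∀ c ts x → combination (scaled c ts) x ≈ c * combination ts x
      combination-scaled c []             x = ≡⇒≈ (sym (*-zeroʳ c))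
      combination-scaled c ((a , i) ∷ ts) x = begin
          (⟦ coeff (c * ⟦ a ⟧) ⟧ * b i x + combination (scaled c ts) x) % m
        ≡⟨ +-≈ (*-≈ (⟦coeff⟧≈ _) refl) (combination-scaled c ts x) ⟩
          (c * ⟦ a ⟧ * b i x + c * combination ts x) % m
        ≡⟨ cong (λ t → (t + c * combination ts x) % m) (*-assoc c ⟦ a ⟧ (b i x)) ⟩
          (c * (⟦ a ⟧ * b i x) + c * combination ts x) % m
        ≡⟨ cong (_% m) (*-distribˡ-+ c _ _) ⟨
          (c * (⟦ a ⟧ * b i x + combination ts x)) % m
        ∎
        where open ≡-Reasoning

      span⇒combination : ∀ {d f} → Span b deg d f →
        Σ[ ts ∈ List (A × I) ] DegreeAtMost d ts × (∀ x → f x ≈ combination ts x)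
      span⇒combination (basis i i≤d) =
        (coeff 1 , i) ∷ [] , i≤d ∷ [] ,
        λ x → sym (trans (+-≈ (*-≈ (⟦coeff⟧≈ 1) refl) refl) (≡⇒≈ (trans (+-identityʳ _) (*-identityˡ _))))
      span⇒combination 0ₛ = [] , [] , λ _ → refl
      span⇒combination (s +ₛ t) with span⇒combination s | span⇒combination t
      ... | ts , ts≤d , f≈ts | us , us≤d , g≈us =
        ts ++ us , ++⁺ ts≤d us≤d ,
        λ x → trans (+-≈ (f≈ts x) (g≈us x)) (≡⇒≈ (sym (combination-++ ts us x)))
      span⇒combination (c *ₛ s) with span⇒combination s
      ... | ts , ts≤d , f≈ts =
        scaled c ts , map⁺ ts≤d ,
        λ x → trans (*-≈ {c} refl (f≈ts x)) (sym (combination-scaled c ts x))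
      span⇒combination (resp f≈g s) with span⇒combination s
      ... | ts , ts≤d , f≈ts = ts , ts≤d , λ x → trans (sym (f≈g x)) (f≈ts x)

module Rⁿ {p : ℕ} (pp : Prime p) (k : ℕ) (1≤k : 1 ≤ k) (n : ℕ) where

  instance
    p≢0 : NonZero p
    p≢0 = prime⇒nonZero pp
    q≢0 : NonZero (p ^ k)
    q≢0 = m^n≢0 p k

  open Modulo p public

  %p^k-≈ : ∀ c → c % (p ^ k) ≈ c
  %p^k-≈ c = m∣n⇒o%n%m≡o%m p (p ^ k) c (m∣m^n 1≤k)

  toℕ-≈⇒≡% : ∀ (a : Fin p) {c} → toℕ a ≈ c → toℕ a ≡ c % p
  toℕ-≈⇒≡% a = trans (sym (m<n⇒m%n≡m (toℕ<n a)))

  toℕ-mod-≈ : ∀ c → toℕ (c mod p) ≈ c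
  toℕ-mod-≈ c = trans (cong (_% p) (toℕ-fromℕ< (m%n<n c p))) (%-≈ c)

  toℕ-mod-p^k-≈ : ∀ c → toℕ (c mod (p ^ k)) ≈ c
  toℕ-mod-p^k-≈ c = trans (cong (_% p) (toℕ-fromℕ< (m%n<n c (p ^ k)))) (%p^k-≈ c)

  binomᶠ : Fin (p ^ k) → ℕ → ℕ
  binomᶠ α = binom (toℕ α)

  monomial : (Fin n → ℕ) → Vecᴿ p k n → ℕ
  monomial e x = tensor pow e (toℕ ∘ x)

  φᵅ≈tensor : ∀ α x → φᵅ pp k n α x ≈ tensor binomᶠ α (toℕ ∘ x)
  φᵅ≈tensor α x = trans (%-≈ _) (Πᶠ-%-≈ n (λ i → toℕ (x i) C toℕ (α i)))

  powers∈span-binomᶠ : ∀ e → e < p ^ k → Span binomᶠ toℕ e (pow e)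
  powers∈span-binomᶠ e e<q = span-trans reindex (powers∈span-binomials e)
    where
      reindex : ∀ j → j ≤ e → Span binomᶠ toℕ e (binom j)
      reindex j j≤e =
        resp (λ y → ≡⇒≈ (cong (y C_) (toℕ-fromℕ< j<q)))
          (basis (fromℕ< j<q) (≤-trans (≤-reflexive (toℕ-fromℕ< j<q)) j≤e))
        where j<q = ≤-<-trans j≤e e<q

  φᵅ∈span-monomials : ∀ {d} → d < p → ∀ α → ∣ α ∣ᵅ ≤ d → Span monomial (monoDeg pp k n) ∣ α ∣ᵅ (φᵅ pp k n α)
  φᵅ∈span-monomials d<p α α≤d =
    resp (λ x → sym (φᵅ≈tensor α x))
      (span-pull (toℕ ∘_)
        (span-tensor (λ β β≤d → binomials∈span-powers pp (toℕ β) (≤-<-trans β≤d d<p)) n α α≤d))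

  monomial∈span-φᵅ : ∀ {d} → d < p → ∀ e → monoDeg pp k n e ≤ d → Span (φᵅ pp k n) ∣_∣ᵅ (monoDeg pp k n e) (monomial e)
  monomial∈span-φᵅ d<p e e≤d =
    span-trans (λ α α≤ → resp (φᵅ≈tensor α) (basis α α≤))
      (span-pull (toℕ ∘_)
        (span-tensor (λ j j≤d → powers∈span-binomᶠ j (≤-<-trans j≤d (<-≤-trans d<p (m≤m^n 1≤k)))) n e e≤d))

  module _ {d : ℕ} {g : Vecᴿ p k n → Fin p} where

    Ω⇒span : InΩ pp k n d g → Span (φᵅ pp k n) ∣_∣ᵅ d (toℕ ∘ g)
    Ω⇒span (terms , terms≤d , g≡) =
      resp (λ x → sym (trans (≡⇒≈ (g≡ x)) (%-≈ _))) (combination∈span toℕ (φᵅ pp k n) ∣_∣ᵅ terms≤d)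

    span⇒Ω : Span (φᵅ pp k n) ∣_∣ᵅ d (toℕ ∘ g) → InΩ pp k n d g
    span⇒Ω s with span⇒combination toℕ (φᵅ pp k n) ∣_∣ᵅ (_mod p) toℕ-mod-≈ s
    ... | ts , ts≤d , g≈ts = ts , ts≤d , λ x → toℕ-≈⇒≡% (g x) (g≈ts x)

    poly⇒span : IsPolyDeg≤ pp k n d g → Span monomial (monoDeg pp k n) d (toℕ ∘ g)
    poly⇒span (P , P≤d , g≡) =
      resp (λ x → sym (trans (≡⇒≈ (g≡ x)) (trans (%-≈ _) (%p^k-≈ _))))
        (combination∈span toℕ monomial (monoDeg pp k n) P≤d)

    span⇒poly : Span monomial (monoDeg pp k n) d (toℕ ∘ g) → IsPolyDeg≤ pp k n d g
    span⇒poly s with span⇒combination toℕ monomial (monoDeg pp k n) (_mod (p ^ k)) toℕ-mod-p^k-≈ s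
    ... | P , P≤d , g≈P = P , P≤d , λ x → trans (toℕ-≈⇒≡% (g x) (g≈P x)) (sym (%p^k-≈ _))

corollary5p7 : ∀ {p : ℕ} (pp : Prime p) (k n : ℕ) → 1 ≤ k →
    (g : Vecᴿ p k n → Fin p) (d : ℕ) → d < p →
    InΩ pp k n d g ⇔ IsPolyDeg≤ pp k n d g
corollary5p7 pp k n 1≤k g d d<p = mk⇔
  (λ g∈Ω → span⇒poly (span-trans (λ α α≤d → span-mono α≤d (φᵅ∈span-monomials d<p α α≤d)) (Ω⇒span g∈Ω)))
  (λ g∈P → span⇒Ω (span-trans (λ e e≤d → span-mono e≤d (monomial∈span-φᵅ d<p e e≤d)) (poly⇒span g∈P)))
  where open Rⁿ pp k 1≤k n
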